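{- Let $\tau,\gamma$ be non-negative integers such that, for some positive integer $\lambda$, $\gamma<\lambda$, $3\gamma+4<\tau$, $2\lambda+\gamma<\tau$ and $6\lambda\le\tau$. Let $S_1,S_2,S_3$ be pairwise disjoint vertex sets and $B(S_1,S_2,S_3)$ a bottleneck sequence on $S_1,S_2,S_3$. Then every $(\tau+\gamma)$-balancing order $\prec$ of $B(S_1,S_2,S_3)$ satisfies $S_1\prec S_2\prec S_3$ or $S_3\prec S_2\prec S_1$.
   Context: A $(\tau,\gamma)$-bottleneck on terminals $v_1,\dots,v_k$ (first terminal $v_1$) is the edge-weighted caterpillar obtained from a path (spine) $a_1b_1\dots a_kb_k$ with $\omega(a_ib_i)=\tau$ and $\omega(b_ia_{i+1})=\gamma+1$, by adding for each $i$ a leaf $v_i$ adjacent to $a_i$ (the attachment of $v_i$) with $\gamma+1\le\omega(v_ia_i)\le\tau-\gamma-1$; it is rooted at $b_k$. A bottleneck sequence $B(S_1,S_2,S_3)$ is obtained by taking three new vertices $s_1,s_2,s_3$ and: for $i\in\{1,2\}$ a bottleneck $B_i^+$ with terminal set $S_i\cup\{s_i\}$, first terminal $s_i$, attachment of $s_i$ of weight $\gamma+1$; for $i\in\{2,3\}$ a bottleneck $B_i^-$ with terminal set $S_i\cup\{s_i\}$, first terminal $s_i$, attachment of $s_i$ of weight $\gamma+1$ (the terminals are shared, the spines are new and otherwise disjoint); for $i\in\{1,2\}$ the roots of $B_i^+$ and $B_{i+1}^-$ are identified into a single vertex; and edges $s_1s_2$ and $s_2s_3$ of weight $\lfloor(\tau+\gamma)/2\rfloor+1$.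 For sets $X,Y$, $X\prec Y$ means $x\prec y$ for all $x\in X,y\in Y$. A total order is $t$-balancing if every vertex $v$ has $\sum_{u\in N(v),u\prec v}\omega(uv)\le t$ and $\sum_{u\in N(v),v\prec u}\omega(uv)\le t$. -}

module Defs where

open import Level using (0ℓ)
open import Data.Nat using (ℕ; zero; suc; _+_; _∸_; _≤_; ⌊_/2⌋)
open import Data.Fin using (Fin; zero; suc; inject₁; fromℕ)
open import Data.Fin.Permutation using (Permutation′; _⟨$⟩ʳ_)
open import Data.List using (List; []; _∷_; _++_; map; allFin; concatMap)
open import Data.Nat.ListAction using (sum)
open import Data.Product using (_×_; _,_)
open import Relation.Binary.Core using (Rel)
open import Relation.Binary.Definitions using (tri<; tri≈; tri>)
open import Relation.Binary.Structures using (IsStrictTotalOrder)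
open import Relation.Binary.PropositionalEquality using (_≡_)

-- Edge-weighted graphs given by a list of weighted edges (x , y , w).
-- (All graphs below are simple, so summing over incident edges equals
-- summing over neighbours.)

WGraph : Set → Set
WGraph V = List (V × V × ℕ)

module _ {V : Set} {_≺_ : Rel V 0ℓ} (sto : IsStrictTotalOrder _≡_ _≺_) where
  open IsStrictTotalOrder sto using (compare)

  predW : V → V → ℕ → V → ℕ
  predW x y w v with compare x v | compare y v
  ... | tri≈ _ _ _ | tri< _ _ _ = w
  ... | _          | _          = 0

  succW : V → V → ℕ → V → ℕ
  succW x y w v with compare x v | compare y v
  ... | tri≈ _ _ _ | tri> _ _ _ = w
  ... | _          | _          = 0

  predSum : WGraph V → V → ℕ
  predSum E v = sum (map (λ { (x , y , w) → predW x y w v + predW y x w v }) E)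

  succSum : WGraph V → V → ℕ
  succSum E v = sum (map (λ { (x , y , w) → succW x y w v + succW y x w v }) E)

  Balancing : ℕ → WGraph V → Set
  Balancing t E = ∀ v → (predSum E v ≤ t) × (succSum E v ≤ t)

-- Bottleneck sequences B(S₁,S₂,S₃).
-- Sⁱ has n i elements (i = 0,1,2 stands for S₁,S₂,S₃).
-- The four bottlenecks are indexed by Fin 4:
--   0 = B₁⁺, 1 = B₂⁺, 2 = B₂⁻, 3 = B₃⁻.

tset : Fin 4 → Fin 3
tset zero                   = zero
tset (suc zero)             = suc zero
tset (suc (suc zero))       = suc zero
tset (suc (suc (suc zero))) = suc (suc zero)

rootOf : Fin 4 → Fin 2      -- root(B₁⁺)=root(B₂⁻), root(B₂⁺)=root(B₃⁻)
rootOf zero                   = zero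
rootOf (suc zero)             = suc zero
rootOf (suc (suc zero))       = zero
rootOf (suc (suc (suc zero))) = suc zero

-- A bottleneck j has k = 1 + n (tset j) terminals, spine
-- a₁ b₁ … a_k b_k; 'spA j p' is a_{p+1} (p < k), 'spB j q' is b_{q+1}
-- for q < k-1, and b_k is the shared root 'root (rootOf j)'.
data BV (n : Fin 3 → ℕ) : Set where
  term : (i : Fin 3) → Fin (n i) → BV n
  sv   : Fin 3 → BV n
  spA  : (j : Fin 4) → Fin (suc (n (tset j))) → BV n
  spB  : (j : Fin 4) → Fin (n (tset j)) → BV n
  root : Fin 2 → BV n

-- The free data of a bottleneck sequence: for each bottleneck j, the
-- order of the terminals of S_{tset j} after the first terminal s
-- (a permutation: position p+1 holds terminal σ p), and the leaf weights
-- (weight of the leaf edge at position p+1).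
record BSData (n : Fin 3 → ℕ) : Set where
  field
    order  : (j : Fin 4) → Permutation′ (n (tset j))
    leafW  : (j : Fin 4) → Fin (n (tset j)) → ℕ

ValidBSData : ℕ → ℕ → {n : Fin 3 → ℕ} → BSData n → Set
ValidBSData τ γ {n} D =
  ∀ j p → (suc γ ≤ BSData.leafW D j p) × (BSData.leafW D j p ≤ τ ∸ γ ∸ 1)

module _ (τ γ : ℕ) {n : Fin 3 → ℕ} (D : BSData n) where
  open BSData D

  bottleneckEdges : (j : Fin 4) → WGraph (BV n)
  bottleneckEdges j =
       map (λ q → (spA j (inject₁ q) , spB j q , τ)) (allFin (n (tset j)))
    ++ ((spA j (fromℕ (n (tset j))) , root (rootOf j) , τ) ∷ [])
    ++ map (λ q → (spB j q , spA j (suc q) , suc γ)) (allFin (n (tset j)))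
    ++ ((sv (tset j) , spA j zero , suc γ) ∷ [])
    ++ map (λ q → (term (tset j) (order j ⟨$⟩ʳ q) , spA j (suc q) , leafW j q))
           (allFin (n (tset j)))

  bottleneckSeq : WGraph (BV n)
  bottleneckSeq =
       concatMap bottleneckEdges (allFin 4)
    ++ (sv zero , sv (suc zero) , suc ⌊ τ + γ /2⌋)
     ∷ (sv (suc zero) , sv (suc (suc zero)) , suc ⌊ τ + γ /2⌋)
     ∷ []

{-# OPTIONS --safe #-}
-- In a (τ+γ)-balancing order no vertex has two lower (or two higher) neighbours whose edge
-- weights sum to more than τ+γ. In a bottleneck, a weight-τ edge a_i b_i and any other edge at
-- the same vertex (weight > γ) form such a pair. Hence if the root b_k lies below a_k, the
-- spine is forced into the order b_k ≺ a_k ≺ b_{k-1} ≺ a_{k-1} ≺ … ≺ a_1, each a_i with its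
-- weight-τ neighbour below it, so every leaf lies above its attachment and all of S_i ∪ {s_i}
-- lies above the root. A shared root has two weight-τ edges (2τ > τ+γ), so it separates the
-- terminal sets of its two bottlenecks; at s₂ the two edges of weight ⌊(τ+γ)/2⌋+1 likewise
-- put s₁ and s₃ on opposite sides, which excludes the two inconsistent ways of combining the
-- separations at the two roots. Each argument is carried out for an abstract order and load,
-- and applied to ≺ with predecessor sums and to its reverse with successor sums.
module Submission where

open import Defs
open import Level using (0ℓ)
open import Data.Nat using (ℕ; suc; _+_; _*_; _<_; _≤_; ⌊_/2⌋; s≤s; z≤n)
open import Data.Nat.Properties
open import Data.Nat.ListAction using (sum)
open import Data.Fin using (Fin; zero; suc; inject₁; fromℕ)
open import Data.Fin.Induction using (>-weakInduction)
open import Data.Fin.Permutation using (_⟨$⟩ʳ_; _⟨$⟩ˡ_; inverseʳ)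
open import Data.List using (List; []; _∷_; _++_; map; allFin; concatMap)
open import Data.List.Properties using (++-assoc)
open import Data.List.Membership.Propositional using (_∈_)
open import Data.List.Membership.Propositional.Properties using (∈-map⁺; ∈-++⁺ˡ; ∈-++⁺ʳ; ∈-allFin)
open import Data.List.Relation.Unary.Any using (here; there)
open import Data.List.Relation.Binary.Sublist.Propositional
  using (_⊆_; []; _∷_; _∷ʳ_; ⊆-refl; ⊆-trans; from∈; ⊆-preorder)
open import Data.List.Relation.Binary.Sublist.Propositional.Properties using (++⁺; ++⁺ˡ; ++⁺ʳ)
import Relation.Binary.Reasoning.Preorder as PreorderReasoning
open import Data.Product using (_×_; Σ; _,_; proj₁; proj₂)
open import Data.Sum using (_⊎_; inj₁; inj₂; swap)
open import Data.Empty using (⊥; ⊥-elim)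
open import Function using (flip; _∘_)
open import Relation.Binary.Core using (Rel)
open import Relation.Binary.Definitions using (tri<; tri≈; tri>; Transitive)
open import Relation.Binary.Structures using (IsStrictTotalOrder)
open import Relation.Binary.PropositionalEquality using (_≡_; _≢_; refl; sym; cong; subst)

Edge : Set → Set
Edge V = V × V × ℕ

sum-map-mono-⊆ : ∀ {A : Set} (f : A → ℕ) {xs ys : List A} → xs ⊆ ys → sum (map f xs) ≤ sum (map f ys)
sum-map-mono-⊆ f []           = ≤-refl
sum-map-mono-⊆ f (y ∷ʳ xs⊆)   = ≤-trans (sum-map-mono-⊆ f xs⊆) (m≤n+m _ (f y))
sum-map-mono-⊆ f (refl ∷ xs⊆) = +-monoʳ-≤ (f _) (sum-map-mono-⊆ f xs⊆)

concatMap⁺ : ∀ {A B : Set} (f : A → List B) {xs ys : List A} → xs ⊆ ys → concatMap f xs ⊆ concatMap f ys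
concatMap⁺ f []           = []
concatMap⁺ f (y ∷ʳ xs⊆)   = ++⁺ˡ (f y) (concatMap⁺ f xs⊆)
concatMap⁺ f (refl ∷ xs⊆) = ++⁺ ⊆-refl (concatMap⁺ f xs⊆)

n<[1+⌊n/2⌋]+[1+⌊n/2⌋] : ∀ n → n < suc ⌊ n /2⌋ + suc ⌊ n /2⌋
n<[1+⌊n/2⌋]+[1+⌊n/2⌋] 0             = s≤s z≤n
n<[1+⌊n/2⌋]+[1+⌊n/2⌋] 1             = s≤s (s≤s z≤n)
n<[1+⌊n/2⌋]+[1+⌊n/2⌋] (suc (suc n)) =
  s≤s (s≤s (subst (suc n ≤_) (sym (+-suc ⌊ n /2⌋ (suc ⌊ n /2⌋))) (n<[1+⌊n/2⌋]+[1+⌊n/2⌋] n)))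

data Joins {V : Set} (v u : V) (w : ℕ) : Edge V → Set where
  fwd : Joins v u w (v , u , w)
  bwd : Joins v u w (u , v , w)

module OneSided {V : Set} (_⊏_ : Rel V 0ℓ) (⊏-connex : ∀ {x y} → x ≢ y → x ⊏ y ⊎ y ⊏ x)
                (load : V → Edge V → ℕ)
                (load-joins : ∀ {v u w e} → u ⊏ v → Joins v u w e → w ≤ load v e)
                (t : ℕ) (E : WGraph V) (load-bounded : ∀ v → sum (map (load v) E) ≤ t) where

  module _ {v u u′ : V} {w w′ : ℕ} {e e′ : Edge V} (e,e′⊆E : e ∷ e′ ∷ [] ⊆ E)
           (ve : Joins v u w e) (ve′ : Joins v u′ w′ e′) (t<w+w′ : t < w + w′) where

    not-both-below : u ⊏ v → u′ ⊏ v → ⊥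
    not-both-below u⊏v u′⊏v = <⇒≱ t<w+w′ (begin
      w + w′                           ≤⟨ +-mono-≤ (load-joins u⊏v ve) (load-joins u′⊏v ve′) ⟩
      load v e + load v e′             ≡⟨ cong (load v e +_) (+-identityʳ (load v e′)) ⟨
      sum (map (load v) (e ∷ e′ ∷ [])) ≤⟨ sum-map-mono-⊆ (load v) e,e′⊆E ⟩
      sum (map (load v) E)             ≤⟨ load-bounded v ⟩
      t                                ∎)
      where open ≤-Reasoning

    second-above : u ⊏ v → u′ ≢ v → v ⊏ u′
    second-above u⊏v u′≢v with ⊏-connex u′≢v
    ... | inj₁ u′⊏v = ⊥-elim (not-both-below u⊏v u′⊏v)
    ... | inj₂ v⊏u′ = v⊏u′

    first-above : u′ ⊏ v → u ≢ v → v ⊏ u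
    first-above u′⊏v u≢v with ⊏-connex u≢v
    ... | inj₁ u⊏v = ⊥-elim (not-both-below u⊏v u′⊏v)
    ... | inj₂ v⊏u = v⊏u

module Bottlenecks (τ γ : ℕ) (γ<τ : γ < τ) {n : Fin 3 → ℕ} (D : BSData n) (valid : ValidBSData τ γ D) where
  open BSData D

  E : WGraph (BV n)
  E = bottleneckSeq τ γ D

  module ⊆-Reasoning = PreorderReasoning (⊆-preorder {A = Edge (BV n)})

  lastA : Fin 4 → BV n
  lastA j = spA j (fromℕ (n (tset j)))

  lastEdge : Fin 4 → Edge (BV n)
  lastEdge j = (lastA j , root (rootOf j) , τ)

  abEdges heavyEdges lightEdges : Fin 4 → WGraph (BV n)
  abEdges j = map (λ q → (spA j (inject₁ q) , spB j q , τ)) (allFin (n (tset j)))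
  heavyEdges j = abEdges j ++ lastEdge j ∷ []
  lightEdges j =
       map (λ q → (spB j q , spA j (suc q) , suc γ)) (allFin (n (tset j)))
    ++ (sv (tset j) , spA j zero , suc γ) ∷ []
    ++ map (λ q → (term (tset j) (order j ⟨$⟩ʳ q) , spA j (suc q) , leafW j q)) (allFin (n (tset j)))

  bottleneckEdges-split : ∀ j → bottleneckEdges τ γ D j ≡ heavyEdges j ++ lightEdges j
  bottleneckEdges-split j = sym (++-assoc (abEdges j) (lastEdge j ∷ []) (lightEdges j))

  bottlenecks-⊆ : ∀ {js} → js ⊆ allFin 4 → concatMap (bottleneckEdges τ γ D) js ⊆ E
  bottlenecks-⊆ js⊆ = ++⁺ʳ _ (concatMap⁺ (bottleneckEdges τ γ D) js⊆)

  heavy-light-⊆ : ∀ {j e e′} → e ∈ heavyEdges j → e′ ∈ lightEdges j → e ∷ e′ ∷ [] ⊆ E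
  heavy-light-⊆ {j} {e} {e′} e∈ e′∈ = begin
    e ∷ e′ ∷ []                                 ∼⟨ ++⁺ (from∈ e∈) (from∈ e′∈) ⟩
    heavyEdges j ++ lightEdges j                ≡⟨ bottleneckEdges-split j ⟨
    bottleneckEdges τ γ D j                     ∼⟨ ++⁺ʳ [] ⊆-refl ⟩
    concatMap (bottleneckEdges τ γ D) (j ∷ [])  ∼⟨ bottlenecks-⊆ (from∈ (∈-allFin j)) ⟩
    E                                           ∎
    where open ⊆-Reasoning

  lastEdges-⊆ : ∀ {j j′} → j ∷ j′ ∷ [] ⊆ allFin 4 → lastEdge j ∷ lastEdge j′ ∷ [] ⊆ E
  lastEdges-⊆ {j} {j′} js⊆ = ⊆-trans (++⁺ (from∈ (lastEdge∈ j)) (++⁺ʳ [] (from∈ (lastEdge∈ j′))))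
                                     (bottlenecks-⊆ js⊆)
    where
    lastEdge∈ : ∀ j → lastEdge j ∈ bottleneckEdges τ γ D j
    lastEdge∈ j = ∈-++⁺ʳ (abEdges j) (here refl)

  sEdges-⊆ :   (sv zero , sv (suc zero) , suc ⌊ τ + γ /2⌋)
             ∷ (sv (suc zero) , sv (suc (suc zero)) , suc ⌊ τ + γ /2⌋) ∷ [] ⊆ E
  sEdges-⊆ = ++⁺ˡ (concatMap (bottleneckEdges τ γ D) (allFin 4)) ⊆-refl

  leafEdge∈ : ∀ j x → let q = order j ⟨$⟩ˡ x in
              (term (tset j) x , spA j (suc q) , leafW j q) ∈ lightEdges j
  leafEdge∈ j x = ∈-++⁺ʳ _ (there (subst (λ y → (term (tset j) y , spA j (suc q) , leafW j q) ∈ _)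
                                         (inverseʳ (order j)) (∈-map⁺ _ (∈-allFin q))))
    where
    q : Fin (n (tset j))
    q = order j ⟨$⟩ˡ x

  module Direction (_⊏_ : Rel (BV n) 0ℓ) (⊏-trans : Transitive _⊏_)
                   (⊏-connex : ∀ {x y} → x ≢ y → x ⊏ y ⊎ y ⊏ x)
                   (load : BV n → Edge (BV n) → ℕ)
                   (load-joins : ∀ {v u w e} → u ⊏ v → Joins v u w e → w ≤ load v e)
                   (load-bounded : ∀ v → sum (map (load v) E) ≤ τ + γ) where
    open OneSided _⊏_ ⊏-connex load load-joins (τ + γ) E load-bounded public

    HeavyDown : (j : Fin 4) → Fin (suc (n (tset j))) → Set
    HeavyDown j p = Σ (BV n) λ u → ((spA j p , u , τ) ∈ heavyEdges j) × (u ⊏ spA j p)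

    heavy-down-step : ∀ {j} q → HeavyDown j (suc q)
                    → spA j (suc q) ⊏ spA j (inject₁ q) × HeavyDown j (inject₁ q)
    heavy-down-step {j} q (u , heavy∈ , u⊏a) = ⊏-trans a⊏b b⊏a′ , spB j q , rung∈ , b⊏a′
      where
      rung∈ : (spA j (inject₁ q) , spB j q , τ) ∈ heavyEdges j
      rung∈ = ∈-++⁺ˡ (∈-map⁺ _ (∈-allFin q))
      link∈ : (spB j q , spA j (suc q) , suc γ) ∈ lightEdges j
      link∈ = ∈-++⁺ˡ (∈-map⁺ _ (∈-allFin q))
      a⊏b : spA j (suc q) ⊏ spB j q
      a⊏b = second-above (heavy-light-⊆ heavy∈ link∈) fwd bwd (+-monoʳ-< τ ≤-refl) u⊏a (λ ())
      b⊏a′ : spB j q ⊏ spA j (inject₁ q)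
      b⊏a′ = first-above (heavy-light-⊆ rung∈ link∈) bwd fwd (+-monoʳ-< τ ≤-refl) a⊏b (λ ())

    AboveRootHeavyDown : (j : Fin 4) → Fin (suc (n (tset j))) → Set
    AboveRootHeavyDown j p = root (rootOf j) ⊏ spA j p × HeavyDown j p

    descend : ∀ {j} → root (rootOf j) ⊏ lastA j → ∀ p → AboveRootHeavyDown j p
    descend {j} r⊏a = >-weakInduction (AboveRootHeavyDown j)
                        (r⊏a , root (rootOf j) , ∈-++⁺ʳ (abEdges j) (here refl) , r⊏a) step
      where
      step : ∀ q → AboveRootHeavyDown j (suc q) → AboveRootHeavyDown j (inject₁ q)
      step q (r⊏a , down) with heavy-down-step q down
      ... | a⊏a′ , down′ = ⊏-trans r⊏a a⊏a′ , down′

    leaf-above : ∀ {j p x w} → HeavyDown j p → (x , spA j p , w) ∈ lightEdges j → γ < w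
               → x ≢ spA j p → spA j p ⊏ x
    leaf-above (u , heavy∈ , u⊏a) leaf∈ γ<w =
      second-above (heavy-light-⊆ heavy∈ leaf∈) fwd bwd (+-monoʳ-< τ γ<w) u⊏a

    Above : BV n → Fin 3 → Set
    Above r i = r ⊏ sv i × ∀ x → r ⊏ term i x

    above-root : ∀ {ρ j} → rootOf j ≡ ρ → root ρ ⊏ lastA j → Above (root ρ) (tset j)
    above-root {j = j} refl r⊏a =
        via (descend r⊏a zero) (∈-++⁺ʳ _ (here refl)) ≤-refl (λ ())
      , λ x → via (descend r⊏a (suc _)) (leafEdge∈ j x) (proj₁ (valid j _)) (λ ())
      where
      via : ∀ {p x w} → AboveRootHeavyDown j p → (x , spA j p , w) ∈ lightEdges j → γ < w
          → x ≢ spA j p → root (rootOf j) ⊏ x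
      via (r⊏a , down) leaf∈ γ<w x≢a = ⊏-trans r⊏a (leaf-above down leaf∈ γ<w x≢a)

    lastJoins : ∀ {ρ j} → rootOf j ≡ ρ → Joins (root ρ) (lastA j) τ (lastEdge j)
    lastJoins refl = bwd

    roots-not-both-below : ∀ {ρ j j′} → j ∷ j′ ∷ [] ⊆ allFin 4 → rootOf j ≡ ρ → rootOf j′ ≡ ρ
                         → lastA j ⊏ root ρ → lastA j′ ⊏ root ρ → ⊥
    roots-not-both-below js⊆ eq eq′ =
      not-both-below (lastEdges-⊆ js⊆) (lastJoins eq) (lastJoins eq′) (+-monoʳ-< τ γ<τ)

    s₂-not-both-below : sv zero ⊏ sv (suc zero) → sv (suc (suc zero)) ⊏ sv (suc zero) → ⊥
    s₂-not-both-below = not-both-below sEdges-⊆ bwd fwd (n<[1+⌊n/2⌋]+[1+⌊n/2⌋] (τ + γ))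

module _ {V : Set} {_≺_ : Rel V 0ℓ} (sto : IsStrictTotalOrder _≡_ _≺_) where
  open IsStrictTotalOrder sto using (compare; irrefl; trans)

  ≢⇒≺⊎≻ : ∀ {x y} → x ≢ y → x ≺ y ⊎ y ≺ x
  ≢⇒≺⊎≻ {x} {y} x≢y with compare x y
  ... | tri< x≺y _ _ = inj₁ x≺y
  ... | tri≈ _ x≡y _ = ⊥-elim (x≢y x≡y)
  ... | tri> _ _ y≺x = inj₂ y≺x

  predW-self : ∀ x y w → y ≺ x → predW sto x y w x ≡ w
  predW-self x y w y≺x with compare x x | compare y x
  ... | tri≈ _ _ _   | tri< _ _ _   = refl
  ... | tri< _ x≢x _ | _            = ⊥-elim (x≢x refl)
  ... | tri> _ x≢x _ | _            = ⊥-elim (x≢x refl)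
  ... | tri≈ _ _ _   | tri≈ _ y≡x _ = ⊥-elim (irrefl y≡x y≺x)
  ... | tri≈ _ _ _   | tri> y⊀x _ _ = ⊥-elim (y⊀x y≺x)

  succW-self : ∀ x y w → x ≺ y → succW sto x y w x ≡ w
  succW-self x y w x≺y with compare x x | compare y x
  ... | tri≈ _ _ _   | tri> _ _ _   = refl
  ... | tri< _ x≢x _ | _            = ⊥-elim (x≢x refl)
  ... | tri> _ x≢x _ | _            = ⊥-elim (x≢x refl)
  ... | tri≈ _ _ _   | tri≈ _ y≡x _ = ⊥-elim (irrefl (sym y≡x) x≺y)
  ... | tri≈ _ _ _   | tri< y≺x _ _ = ⊥-elim (irrefl refl (trans x≺y y≺x))

  predLoad succLoad : V → Edge V → ℕ
  predLoad v (x , y , w) = predW sto x y w v + predW sto y x w v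
  succLoad v (x , y , w) = succW sto x y w v + succW sto y x w v

  predLoad-joins : ∀ {v u w e} → u ≺ v → Joins v u w e → w ≤ predLoad v e
  predLoad-joins {v} {u} {w} u≺v fwd rewrite predW-self v u w u≺v = m≤m+n w _
  predLoad-joins {v} {u} {w} u≺v bwd rewrite predW-self v u w u≺v = m≤n+m w _

  succLoad-joins : ∀ {v u w e} → v ≺ u → Joins v u w e → w ≤ succLoad v e
  succLoad-joins {v} {u} {w} v≺u fwd rewrite succW-self v u w v≺u = m≤m+n w _
  succLoad-joins {v} {u} {w} v≺u bwd rewrite succW-self v u w v≺u = m≤n+m w _

module BalancedOrder (τ γ : ℕ) (γ<τ : γ < τ) {n : Fin 3 → ℕ} (D : BSData n) (valid : ValidBSData τ γ D)
                     {_≺_ : Rel (BV n) 0ℓ} (sto : IsStrictTotalOrder _≡_ _≺_)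
                     (balanced : Balancing sto (τ + γ) (bottleneckSeq τ γ D)) where
  open IsStrictTotalOrder sto using (trans)
  open Bottlenecks τ γ γ<τ D valid

  module ≺ = Direction _≺_ trans (≢⇒≺⊎≻ sto) (predLoad sto) (predLoad-joins sto) (proj₁ ∘ balanced)
  module ≻ = Direction (flip _≺_) (flip trans) (swap ∘ ≢⇒≺⊎≻ sto)
                       (succLoad sto) (succLoad-joins sto) (proj₂ ∘ balanced)

  Above Below : BV n → Fin 3 → Set
  Above = ≺.Above
  Below = ≻.Above

  Separates : BV n → Fin 3 → Fin 3 → Set
  Separates r i i′ = (Above r i × Below r i′) ⊎ (Below r i × Above r i′)

  separates : ∀ {ρ j j′} → j ∷ j′ ∷ [] ⊆ allFin 4 → rootOf j ≡ ρ → rootOf j′ ≡ ρ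
            → Separates (root ρ) (tset j) (tset j′)
  separates {ρ} {j} {j′} js⊆ eq eq′
    with ≢⇒≺⊎≻ sto {root ρ} {lastA j} (λ ()) | ≢⇒≺⊎≻ sto {root ρ} {lastA j′} (λ ())
  ... | inj₁ r≺a | inj₁ r≺a′ = ⊥-elim (≻.roots-not-both-below js⊆ eq eq′ r≺a r≺a′)
  ... | inj₁ r≺a | inj₂ a′≺r = inj₁ (≺.above-root eq r≺a , ≻.above-root eq′ a′≺r)
  ... | inj₂ a≺r | inj₁ r≺a′ = inj₂ (≻.above-root eq a≺r , ≺.above-root eq′ r≺a′)
  ... | inj₂ a≺r | inj₂ a′≺r = ⊥-elim (≺.roots-not-both-below js⊆ eq eq′ a≺r a′≺r)

  module _ {r : BV n} {i i′ : Fin 3} (below : Below r i) (above : Above r i′) where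
    sv-across : sv i ≺ sv i′
    sv-across = trans (proj₁ below) (proj₁ above)

    terms-across : ∀ x y → term i x ≺ term i′ y
    terms-across x y = trans (proj₂ below x) (proj₂ above y)

  terminals-ordered :
      ((∀ x y → term zero x ≺ term (suc zero) y) × (∀ y z → term (suc zero) y ≺ term (suc (suc zero)) z))
    ⊎ ((∀ z y → term (suc (suc zero)) z ≺ term (suc zero) y) × (∀ y x → term (suc zero) y ≺ term zero x))
  terminals-ordered
    with separates {j = zero} {suc (suc zero)} (refl ∷ _ ∷ʳ refl ∷ _ ∷ʳ []) refl refl
       | separates {j = suc zero} {suc (suc (suc zero))} (_ ∷ʳ refl ∷ _ ∷ʳ refl ∷ []) refl refl
  ... | inj₂ (S₁↓ , S₂↑) | inj₂ (S₂↓ , S₃↑) = inj₁ (terms-across S₁↓ S₂↑ , terms-across S₂↓ S₃↑)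
  ... | inj₁ (S₁↑ , S₂↓) | inj₁ (S₂↑ , S₃↓) = inj₂ (terms-across S₃↓ S₂↑ , terms-across S₂↓ S₁↑)
  ... | inj₁ (S₁↑ , S₂↓) | inj₂ (S₂↓′ , S₃↑) =
    ⊥-elim (≻.s₂-not-both-below (sv-across S₂↓ S₁↑) (sv-across S₂↓′ S₃↑))
  ... | inj₂ (S₁↓ , S₂↑) | inj₁ (S₂↑′ , S₃↓) =
    ⊥-elim (≺.s₂-not-both-below (sv-across S₁↓ S₂↑) (sv-across S₃↓ S₂↑′))

lemma9 : (τ γ : ℕ)
    → Σ ℕ (λ λ′ → (0 < λ′) × (γ < λ′) × (3 * γ + 4 < τ) × (2 * λ′ + γ < τ) × (6 * λ′ ≤ τ))
    → (n : Fin 3 → ℕ) (D : BSData n) → ValidBSData τ γ D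
    → (_≺_ : Rel (BV n) 0ℓ) (sto : IsStrictTotalOrder _≡_ _≺_)
    → Balancing sto (τ + γ) (bottleneckSeq τ γ D)
    → (((x : Fin (n zero)) (y : Fin (n (suc zero))) → term zero x ≺ term (suc zero) y)
        × ((y : Fin (n (suc zero))) (z : Fin (n (suc (suc zero)))) → term (suc zero) y ≺ term (suc (suc zero)) z))
      ⊎ (((z : Fin (n (suc (suc zero)))) (y : Fin (n (suc zero))) → term (suc (suc zero)) z ≺ term (suc zero) y)
        × ((y : Fin (n (suc zero))) (x : Fin (n zero)) → term (suc zero) y ≺ term zero x))
lemma9 τ γ (_ , _ , _ , 3γ+4<τ , _) n D valid _≺_ sto balanced =
  BalancedOrder.terminals-ordered τ γ γ<τ D valid sto balanced
  where
  γ<τ : γ < τ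
  γ<τ = ≤-<-trans (≤-trans (m≤m+n γ (2 * γ)) (m≤m+n (3 * γ) 4)) 3γ+4<τ
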